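{- As $k\to\infty$, $\log m'(k)=k\log k+O(k)$, where $m'(k)=\prod_{p} p^{a_p(k)}$ (product over all primes).
   Context: For a prime $p$ and integer $m$, $\nu_p(m)$ denotes the largest $r$ with $p^r\mid m$, with $\nu_p(0)=\infty$. Let $e_p(k)=\nu_p(k!)$ and, for integers $n$, $f_{p,k}(n)=\sum_{j=0}^{k-1}\nu_p(n-j)$. For primes $p\le k$, $a_p(k)$ is the smallest integer $m\ge 0$ such that whether or not $f_{p,k}(n)\ge 2e_p(k)$ holds depends only on the congruence class of $n$ modulo $p^m$; for primes $p>k$, $a_p(k)=0$. (The paper identifies $m'(k)=\prod_p p^{a_p(k)}$ with the least modulus $T(k)$ such that the condition "$j!\mid\binom{n}{j}$ for all $1\le j\le k$" depends only on $n$ modulo $T(k)$.) -}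

module Defs where

open import Data.Nat using (ℕ; zero; suc; _+_; _*_; _^_; _≤_; _<_; _!)
open import Data.Unit using (⊤)
open import Data.Nat.Divisibility using (_∣?_; divides)
open import Data.Nat.Primality using (Prime; prime?)
open import Data.Integer as ℤ using (ℤ; +_; ∣_∣)
open import Data.Integer.Divisibility as ℤD using ()
open import Data.List using (List; map; upTo)
open import Data.Nat.ListAction using (product)
open import Data.Bool using (if_then_else_)
open import Data.Product using (_×_)
open import Function.Bundles using (_⇔_)
open import Relation.Nullary using (yes; no; does)
open import Relation.Binary.PropositionalEquality using (_≡_)

-- p-adic valuation of a positive natural number m, computed with fuel m
-- (for p ≥ 2 and m ≥ 1 the valuation is < m, so fuel m suffices).
valGo : ℕ → ℕ → ℕ → ℕ
valGo zero    p m = 0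
valGo (suc f) p m with p ∣? m
... | yes (divides q _) = suc (valGo f p q)
... | no  _             = 0

valℕ : ℕ → ℕ → ℕ
valℕ p m = valGo m p m

data ℕ∞ : Set where
  fin : ℕ → ℕ∞
  ∞   : ℕ∞

_+∞_ : ℕ∞ → ℕ∞ → ℕ∞
fin a +∞ fin b = fin (a + b)
fin _ +∞ ∞     = ∞
∞     +∞ _     = ∞

_≥∞_ : ℕ∞ → ℕ → Set
fin a ≥∞ n = n ≤ a
∞     ≥∞ n = ⊤

ν : ℕ → ℤ → ℕ∞
ν p (+ zero) = ∞
ν p m        = fin (valℕ p ∣ m ∣)

e : ℕ → ℕ → ℕ
e p k = valℕ p (k !)

f : ℕ → ℕ → ℤ → ℕ∞
f p zero    n = fin 0
f p (suc k) n = f p k n +∞ ν p (n ℤ.- + k)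

Cond : ℕ → ℕ → ℤ → Set
Cond p k n = f p k n ≥∞ (2 * e p k)

DependsMod : ℕ → ℕ → ℕ → Set
DependsMod p k m = ∀ (n n′ : ℤ) → (+ (p ^ m)) ℤD.∣ (n ℤ.- n′) → (Cond p k n ⇔ Cond p k n′)

Least : (ℕ → Set) → ℕ → Set
Least P m = P m × (∀ m′ → P m′ → m ≤ m′)

IsA : (ℕ → ℕ → ℕ) → Set
IsA a = ∀ p k → Prime p →
          ((p ≤ k → Least (DependsMod p k) (a p k)) × (k < p → a p k ≡ 0))

-- m'(k) = ∏_p p^{a_p(k)}; primes p > k contribute p^0 = 1, so the product
-- over primes p ≤ k (here: over all p ≤ k, non-primes contributing 1).
m′ : (ℕ → ℕ → ℕ) → ℕ → ℕ
m′ a k = product (map (λ p → if does (prime? p) then p ^ a p k else 1) (upTo (suc k)))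

module Submission where

-- Fix a prime p ≤ k and write E = e_p(k), L = ⌊log_p k⌋.  The heart of the proof is the estimate
--   E - L - 1 ≤ a_p(k) ≤ E + L.
-- For natural x ≥ k, f_{p,k}(x) = ν_p(x (x-1) ⋯ (x-k+1)) = E + ν_p(C(x,k)), so the condition
-- f_{p,k}(x) ≥ 2E says p^E ∣ C(x,k).  If p^(E+L) ∣ h then p^E ∣ C(h,i) for 1 ≤ i ≤ k (absorption
-- identity), hence C(x+h,k) ≡ C(x,k) (mod p^E) by Pascal's rule; a truncation argument shows that
-- the condition is in any case p^(3E+L)-periodic on ℤ, which reduces integers to naturals.  So
-- p^(E+L) is a period.  Conversely, for L < m < E the points k-1 and p^m+k-1 show that p^m is not.
--
-- Taking the product over p ≤ k, with ∏_p p^E = k! and Λ(k) = ∏_p p^L ≤ 128ᵏ (primes p ≤ √k give at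
-- most k each, the others give p, and ∏_{p ≤ k} p ≤ 8ᵏ by Chebyshev's central binomial argument):
--   k! ≤ m′(k) Λ(k) ∏_{p ≤ k} p   and   m′(k) ≤ k! Λ(k);
-- together with k! ≤ kᵏ ≤ 8ᵏ k! this gives the corollary.

open import Data.Nat
open import Data.Nat.Properties
open import Data.Nat.Divisibility
open import Data.Nat.DivMod using (_%_; %-distribˡ-+)
open import Data.Nat.Primality
open import Data.Nat.Induction using (<-rec)
open import Data.Nat.ListAction using (product)
open import Data.Nat.ListAction.Properties using (product-++)
open import Data.Nat.Tactic.RingSolver using (solve-∀)
open import Data.Integer as ℤ using (ℤ; +_; ∣_∣)
import Data.Integer.Properties as ℤP
import Data.Integer.Divisibility as ℤD
open import Data.Integer.Divisibility.Signed as ℤS using (∣ᵤ⇒∣; ∣⇒∣ᵤ)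
open import Data.Integer.DivMod using (a≡a%ℕn+[a/ℕn]*n)
import Data.Integer.Tactic.RingSolver as ℤSolver
open import Data.List using ([]; _∷_; _++_; map; upTo)
open import Data.List.Properties using (upTo-∷ʳ; map-++)
open import Data.Bool using (true; false; T; if_then_else_)
open import Data.Product using (_×_; _,_; ∃-syntax; proj₁; proj₂)
open import Data.Sum using (inj₁; inj₂)
open import Data.Empty using (⊥-elim)
open import Data.Unit using (tt)
open import Function.Bundles using (_⇔_; mk⇔; Equivalence)
open import Relation.Nullary using (¬_; yes; no; does)
open import Relation.Binary.PropositionalEquality

open import Defs

open Equivalence using (to; from)

prime≥2 : ∀ {p} → Prime p → 2 ≤ p
prime≥2 {p} pp = nonTrivial⇒n>1 p {{prime⇒nonTrivial pp}}

≥2⇒≥1 : ∀ {p} → 2 ≤ p → 1 ≤ p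
≥2⇒≥1 (s≤s _) = s≤s z≤n

pow≥1 : ∀ p r → 1 ≤ p → 1 ≤ p ^ r
pow≥1 p r 1≤p = m^n>0 p {{>-nonZero 1≤p}} r

factor≥1 : ∀ {m q p} → 1 ≤ m → m ≡ q * p → 1 ≤ q
factor≥1 {q = zero}  1≤m refl = 1≤m
factor≥1 {q = suc _} _   _    = s≤s z≤n

¬∣⇒≥1 : ∀ {p u} → ¬ p ∣ u → 1 ≤ u
¬∣⇒≥1 {u = zero}  p∤u = ⊥-elim (p∤u (divides 0 refl))
¬∣⇒≥1 {u = suc _} _   = s≤s z≤n

p∤1 : ∀ {p} → 2 ≤ p → ¬ p ∣ 1
p∤1 (s≤s (s≤s _)) p∣1 with ∣1⇒≡1 p∣1
... | ()

pow∣pow : ∀ p {r s} → r ≤ s → p ^ r ∣ p ^ s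
pow∣pow p {r} {s} r≤s = divides (p ^ (s ∸ r))
  (trans (cong (p ^_) (sym (m∸n+n≡m r≤s))) (^-distribˡ-+-* p (s ∸ r) r))

-- The p-adic valuation.  For 2 ≤ p and m ≥ 1, `valℕ p m` is characterised by
-- m = p ^ valℕ p m * u with p ∤ u; everything below follows from this.

valGo-split : ∀ fuel {p m} → 2 ≤ p → 1 ≤ m → m ≤ fuel →
              ∃[ u ] (m ≡ p ^ valGo fuel p m * u) × ¬ p ∣ u
valGo-split zero    _ 1≤m m≤0 = ⊥-elim (<-irrefl refl (≤-trans 1≤m m≤0))
valGo-split (suc fuel) {p} {m} 2≤p 1≤m m≤fuel with p ∣? m
... | no p∤m = m , sym (*-identityˡ m) , p∤m
... | yes (divides q m≡qp) = u , m≡ , p∤u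
  where
  q<m : q < m
  q<m = ≤-trans (m<m*n q p {{>-nonZero (factor≥1 1≤m m≡qp)}} 2≤p) (≤-reflexive (sym m≡qp))
  split-q = valGo-split fuel 2≤p (factor≥1 1≤m m≡qp) (≤-pred (≤-trans q<m m≤fuel))
  u = proj₁ split-q
  p∤u = proj₂ (proj₂ split-q)
  v = valGo fuel p q
  m≡ : m ≡ p ^ suc v * u
  m≡ = begin
    m               ≡⟨ m≡qp ⟩
    q * p           ≡⟨ cong (_* p) (proj₁ (proj₂ split-q)) ⟩
    p ^ v * u * p   ≡⟨ rotate (p ^ v) u p ⟩
    p * p ^ v * u   ∎
    where
    open ≡-Reasoning
    rotate : ∀ x y z → x * y * z ≡ z * x * y
    rotate = solve-∀

val-split : ∀ {p m} → 2 ≤ p → 1 ≤ m → ∃[ u ] (m ≡ p ^ valℕ p m * u) × ¬ p ∣ u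
val-split {m = m} 2≤p 1≤m = valGo-split m 2≤p 1≤m ≤-refl

pow-unique : ∀ {p} r s {u w} → 2 ≤ p → ¬ p ∣ u → ¬ p ∣ w → p ^ r * u ≡ p ^ s * w → r ≡ s
pow-unique zero zero _ _ _ _ = refl
pow-unique {p} zero (suc s) {u} {w} _ p∤u _ eq =
  ⊥-elim (p∤u (divides (p ^ s * w) (trans (trans (sym (+-identityʳ u)) eq)
    (trans (*-assoc p (p ^ s) w) (*-comm p (p ^ s * w))))))
pow-unique (suc r) zero 2≤p p∤u p∤w eq = sym (pow-unique zero (suc r) 2≤p p∤w p∤u (sym eq))
pow-unique {p} (suc r) (suc s) {u} {w} 2≤p p∤u p∤w eq =
  cong suc (pow-unique r s 2≤p p∤u p∤w (*-cancelˡ-≡ _ _ p {{>-nonZero (≥2⇒≥1 2≤p)}}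
    (trans (sym (*-assoc p (p ^ r) u)) (trans eq (*-assoc p (p ^ s) w)))))

val-unique : ∀ {p m r u} → 2 ≤ p → m ≡ p ^ r * u → ¬ p ∣ u → valℕ p m ≡ r
val-unique {p} {m} {r} {u} 2≤p m≡ p∤u =
  pow-unique _ r 2≤p (proj₂ (proj₂ split-m)) p∤u (trans (sym (proj₁ (proj₂ split-m))) m≡)
  where
  1≤m : 1 ≤ m
  1≤m = subst (1 ≤_) (sym m≡) (*-mono-≤ (pow≥1 p r (≥2⇒≥1 2≤p)) (¬∣⇒≥1 p∤u))
  split-m = val-split {p} {m} 2≤p 1≤m

val-pow : ∀ {p} r → 2 ≤ p → valℕ p (p ^ r) ≡ r
val-pow {p} r 2≤p = val-unique 2≤p (sym (*-identityʳ (p ^ r))) (p∤1 2≤p)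

val-1 : ∀ {p} → 2 ≤ p → valℕ p 1 ≡ 0
val-1 = val-pow 0

-- Multiplicativity ν_p(ab) = ν_p(a) + ν_p(b); this is where primality (Euclid's lemma) enters.
val-* : ∀ {p a b} → Prime p → 1 ≤ a → 1 ≤ b → valℕ p (a * b) ≡ valℕ p a + valℕ p b
val-* {p} {a} {b} pp 1≤a 1≤b = val-unique (prime≥2 pp) ab≡ p∤uv
  where
  split-a = val-split {p} {a} (prime≥2 pp) 1≤a
  split-b = val-split {p} {b} (prime≥2 pp) 1≤b
  u = proj₁ split-a
  w = proj₁ split-b
  p∤uv : ¬ p ∣ u * w
  p∤uv p∣uw with euclidsLemma u w pp p∣uw
  ... | inj₁ p∣u = proj₂ (proj₂ split-a) p∣u
  ... | inj₂ p∣w = proj₂ (proj₂ split-b) p∣w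
  ab≡ : a * b ≡ p ^ (valℕ p a + valℕ p b) * (u * w)
  ab≡ = begin
    a * b                                   ≡⟨ cong₂ _*_ (proj₁ (proj₂ split-a)) (proj₁ (proj₂ split-b)) ⟩
    p ^ valℕ p a * u * (p ^ valℕ p b * w)   ≡⟨ interchange (p ^ valℕ p a) u (p ^ valℕ p b) w ⟩
    p ^ valℕ p a * p ^ valℕ p b * (u * w)   ≡⟨ cong (_* (u * w)) (sym (^-distribˡ-+-* p (valℕ p a) (valℕ p b))) ⟩
    p ^ (valℕ p a + valℕ p b) * (u * w)     ∎
    where
    open ≡-Reasoning
    interchange : ∀ x y z t → x * y * (z * t) ≡ x * z * (y * t)
    interchange = solve-∀

val-∣⇐ : ∀ {p m r} → 2 ≤ p → 1 ≤ m → r ≤ valℕ p m → p ^ r ∣ m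
val-∣⇐ {p} {m} 2≤p 1≤m r≤v =
  ∣-trans (pow∣pow p r≤v) (divides u (trans m≡ (*-comm _ u)))
  where
  u = proj₁ (val-split {p} {m} 2≤p 1≤m)
  m≡ = proj₁ (proj₂ (val-split {p} {m} 2≤p 1≤m))

val-∣⇒ : ∀ {p m r} → Prime p → 1 ≤ m → p ^ r ∣ m → r ≤ valℕ p m
val-∣⇒ {p} {m} {r} pp 1≤m (divides c m≡cpʳ) = subst (r ≤_) (sym val-m) (m≤n+m r (valℕ p c))
  where
  2≤p = prime≥2 pp
  val-m : valℕ p m ≡ valℕ p c + r
  val-m = trans (cong (valℕ p) m≡cpʳ)
    (trans (val-* {p} {c} {p ^ r} pp (factor≥1 1≤m m≡cpʳ) (pow≥1 p r (≥2⇒≥1 2≤p))) (cong (_+_ (valℕ p c)) (val-pow r 2≤p)))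

val-< : ∀ {p i s} → 2 ≤ p → 1 ≤ i → i < p ^ s → valℕ p i < s
val-< {p} {i} {s} 2≤p 1≤i i<pˢ with valℕ p i <? s
... | yes v<s = v<s
... | no v≮s = ⊥-elim (<-irrefl refl (<-≤-trans i<pˢ (≤-trans
      (^-monoʳ-≤ p {{>-nonZero (≥2⇒≥1 2≤p)}} (≮⇒≥ v≮s)) (∣⇒≤ {{>-nonZero 1≤i}} (val-∣⇐ 2≤p 1≤i ≤-refl)))))

val-shift : ∀ {p m i} → 2 ≤ p → 1 ≤ i → i < p ^ m → valℕ p (p ^ m + i) ≡ valℕ p i
val-shift {p} {m} {i} 2≤p 1≤i i<pᵐ = val-unique 2≤p pᵐ+i≡ p∤w
  where
  split-i = val-split {p} {i} 2≤p 1≤i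
  v = valℕ p i
  u = proj₁ split-i
  v<m : v < m
  v<m = val-< 2≤p 1≤i i<pᵐ
  w = p ^ (m ∸ v) + u
  p∣pᵐ⁻ᵛ : p ∣ p ^ (m ∸ v)
  p∣pᵐ⁻ᵛ = subst (_∣ p ^ (m ∸ v)) (*-identityʳ p) (pow∣pow p (m<n⇒0<n∸m v<m))
  p∤w : ¬ p ∣ w
  p∤w p∣w = proj₂ (proj₂ split-i) (∣m+n∣m⇒∣n p∣w p∣pᵐ⁻ᵛ)
  pᵐ+i≡ : p ^ m + i ≡ p ^ v * w
  pᵐ+i≡ = begin
    p ^ m + i                       ≡⟨ cong₂ _+_ (trans (cong (p ^_) (sym (m+[n∸m]≡n (<⇒≤ v<m))))
                                                 (^-distribˡ-+-* p v (m ∸ v))) (proj₁ (proj₂ split-i)) ⟩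
    p ^ v * p ^ (m ∸ v) + p ^ v * u ≡⟨ sym (*-distribˡ-+ (p ^ v) _ u) ⟩
    p ^ v * w                       ∎
    where open ≡-Reasoning

choose : ℕ → ℕ → ℕ
choose n       zero    = 1
choose zero    (suc k) = 0
choose (suc n) (suc k) = choose n k + choose n (suc k)

falling : ℕ → ℕ → ℕ
falling n zero    = 1
falling n (suc k) = n * falling (pred n) k

choose-< : ∀ n k → n < k → choose n k ≡ 0
choose-< zero    (suc k) _         = refl
choose-< (suc n) (suc k) (s≤s n<k) = cong₂ _+_ (choose-< n k n<k) (choose-< n (suc k) (m≤n⇒m≤1+n n<k))

choose-≥1 : ∀ n k → k ≤ n → 1 ≤ choose n k
choose-≥1 n       zero    _         = s≤s z≤n
choose-≥1 (suc n) (suc k) (s≤s k≤n) = ≤-trans (choose-≥1 n k k≤n) (m≤m+n _ _)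

choose-≤ : ∀ n k → choose n k ≤ 2 ^ n
choose-≤ n       zero    = pow≥1 2 n (s≤s z≤n)
choose-≤ zero    (suc k) = z≤n
choose-≤ (suc n) (suc k) = ≤-trans (+-mono-≤ (choose-≤ n k) (choose-≤ n (suc k)))
  (≤-reflexive (cong (_+_ (2 ^ n)) (sym (+-identityʳ (2 ^ n)))))

choose-1 : ∀ n → choose n 1 ≡ n
choose-1 zero    = refl
choose-1 (suc n) = cong suc (choose-1 n)

absorption : ∀ n k → suc k * choose (suc n) (suc k) ≡ suc n * choose n k
absorption zero    zero    = refl
absorption zero    (suc k) = *-zeroʳ (suc (suc k))
absorption (suc n) zero    = trans (*-identityˡ _) (trans (choose-1 (suc (suc n))) (sym (*-identityʳ _)))
absorption (suc n) (suc k) = begin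
    (2 + k) * (A + B)               ≡⟨ expand k A B ⟩
    (1 + k) * A + A + (2 + k) * B   ≡⟨ cong₂ (λ s t → s + A + t) (absorption n k) (absorption n (suc k)) ⟩
    (1 + n) * X + A + (1 + n) * Y   ≡⟨ collect n X Y ⟩
    (2 + n) * A                     ∎
  where
  open ≡-Reasoning
  X = choose n k
  Y = choose n (suc k)
  A = choose (suc n) (suc k)
  B = choose (suc n) (suc (suc k))
  expand : ∀ k A B → (2 + k) * (A + B) ≡ (1 + k) * A + A + (2 + k) * B
  expand = solve-∀
  collect : ∀ n X Y → (1 + n) * X + (X + Y) + (1 + n) * Y ≡ (2 + n) * (X + Y)
  collect = solve-∀

falling≡ : ∀ n k → falling n k ≡ k ! * choose n k
falling≡ n       zero    = refl
falling≡ zero    (suc k) = sym (*-zeroʳ (suc k !))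
falling≡ (suc n) (suc k) = begin
  suc n * falling n k                     ≡⟨ cong (suc n *_) (falling≡ n k) ⟩
  suc n * (k ! * choose n k)              ≡⟨ swap (suc n) (k !) (choose n k) ⟩
  k ! * (suc n * choose n k)              ≡⟨ cong (k ! *_) (sym (absorption n k)) ⟩
  k ! * (suc k * choose (suc n) (suc k))  ≡⟨ reassoc (k !) (suc k) (choose (suc n) (suc k)) ⟩
  suc k * k ! * choose (suc n) (suc k)    ∎
  where
  open ≡-Reasoning
  swap : ∀ a b c → a * (b * c) ≡ b * (a * c)
  swap = solve-∀
  reassoc : ∀ a b c → a * (b * c) ≡ b * a * c
  reassoc = solve-∀

falling-last : ∀ n k → falling n (suc k) ≡ falling n k * (n ∸ k)
falling-last n       zero    = trans (*-identityʳ n) (sym (*-identityˡ n))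
falling-last zero    (suc k) = refl
falling-last (suc n) (suc k) = trans (cong (suc n *_) (falling-last n k)) (sym (*-assoc (suc n) (falling n k) (n ∸ k)))

falling≥1 : ∀ n k → k ≤ n → 1 ≤ falling n k
falling≥1 n k k≤n = subst (1 ≤_) (sym (falling≡ n k)) (*-mono-≤ (1≤n! k) (choose-≥1 n k k≤n))

-- If d divides C(h,i) for 1 ≤ i ≤ K, then C(n+h,k) ≡ C(n,k) (mod d) for k ≤ K:
-- induction on n via Pascal's rule, starting from C(h,k) ≡ C(0,k).
choose-shift : ∀ d .{{_ : NonZero d}} h K → (∀ i → 1 ≤ i → i ≤ K → d ∣ choose h i) →
               ∀ n k → k ≤ K → choose (n + h) k % d ≡ choose n k % d
choose-shift d h K d∣ zero    zero    _   = refl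
choose-shift d h K d∣ zero    (suc k) k<K =
  trans (n∣m⇒m%n≡0 _ d (d∣ (suc k) (s≤s z≤n) k<K)) (sym (n∣m⇒m%n≡0 0 d (divides 0 refl)))
choose-shift d h K d∣ (suc n) zero    _   = refl
choose-shift d h K d∣ (suc n) (suc k) k<K = begin
  (choose (n + h) k + choose (n + h) (suc k)) % d            ≡⟨ %-distribˡ-+ (choose (n + h) k) _ d ⟩
  (choose (n + h) k % d + choose (n + h) (suc k) % d) % d    ≡⟨ cong₂ (λ s t → (s + t) % d)
                                                                   (choose-shift d h K d∣ n k (<⇒≤ k<K))
                                                                   (choose-shift d h K d∣ n (suc k) k<K) ⟩
  (choose n k % d + choose n (suc k) % d) % d                ≡⟨ sym (%-distribˡ-+ (choose n k) _ d) ⟩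
  (choose n k + choose n (suc k)) % d                        ∎
  where open ≡-Reasoning

-- For a natural number x the condition of the paper becomes a divisibility of a binomial
-- coefficient: f_{p,k}(x) = ν_p(x (x-1) ⋯ (x-k+1)) = e_p(k) + ν_p(C(x,k)) when k ≤ x, while
-- f_{p,k}(x) = ∞ and C(x,k) = 0 when x < k.

+∞-absorbs : ∀ a → a +∞ ∞ ≡ ∞
+∞-absorbs (fin _) = refl
+∞-absorbs ∞       = refl

ν-pos : ∀ {p x} → 1 ≤ x → ν p (+ x) ≡ fin (valℕ p x)
ν-pos {x = suc _} _ = refl

+-minus-+ : ∀ x k → k ≤ x → + x ℤ.- + k ≡ + (x ∸ k)
+-minus-+ x k k≤x = trans (ℤP.[+m]-[+n]≡m⊖n x k) (ℤP.⊖-≥ k≤x)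

f-nat : ∀ {p} k x → Prime p → k ≤ x → f p k (+ x) ≡ fin (valℕ p (falling x k))
f-nat {p} zero    x pp _   = cong fin (sym (val-1 (prime≥2 pp)))
f-nat {p} (suc k) x pp k<x = begin
  f p k (+ x) +∞ ν p (+ x ℤ.- + k)              ≡⟨ cong₂ _+∞_ (f-nat k x pp (<⇒≤ k<x))
                                                      (trans (cong (ν p) (+-minus-+ x k (<⇒≤ k<x))) (ν-pos (m<n⇒0<n∸m k<x))) ⟩
  fin (valℕ p (falling x k) + valℕ p (x ∸ k))   ≡⟨ cong fin (sym (val-* pp (falling≥1 x k (<⇒≤ k<x)) (m<n⇒0<n∸m k<x))) ⟩
  fin (valℕ p (falling x k * (x ∸ k)))          ≡⟨ cong (λ t → fin (valℕ p t)) (sym (falling-last x k)) ⟩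
  fin (valℕ p (falling x (suc k)))              ∎
  where open ≡-Reasoning

-- For x < k one of the factors x - j is zero.
f-∞ : ∀ {p} k x → x < k → f p k (+ x) ≡ ∞
f-∞ {p} (suc k) x (s≤s x≤k) with m≤n⇒m<n∨m≡n x≤k
... | inj₁ x<k  = cong (_+∞ ν p (+ x ℤ.- + k)) (f-∞ k x x<k)
... | inj₂ refl = trans (cong (λ t → f p x (+ x) +∞ ν p t) (trans (+-minus-+ x x ≤-refl) (cong +_ (n∸n≡0 x))))
                        (+∞-absorbs _)

2*≡ : ∀ m → 2 * m ≡ m + m
2*≡ m = cong (_+_ m) (+-identityʳ m)

cond-nat : ∀ {p} k x → Prime p → Cond p k (+ x) ⇔ (p ^ e p k ∣ choose x k)
cond-nat {p} k x pp with k ≤? x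
... | no k≰x = mk⇔ (λ _ → subst (p ^ e p k ∣_) (sym (choose-< x k (≰⇒> k≰x))) (divides 0 refl))
                   (λ _ → subst (_≥∞ (2 * e p k)) (sym (f-∞ k x (≰⇒> k≰x))) tt)
... | yes k≤x = mk⇔
    (λ c → val-∣⇐ (prime≥2 pp) 1≤C (+-cancelˡ-≤ E E v (subst (_≤ E + v) (2*≡ E) (subst (_≥∞ (2 * E)) f≡ c))))
    (λ d → subst (_≥∞ (2 * E)) (sym f≡) (subst (_≤ E + v) (sym (2*≡ E)) (+-monoʳ-≤ E (val-∣⇒ pp 1≤C d))))
  where
  E = e p k
  v = valℕ p (choose x k)
  1≤C = choose-≥1 x k k≤x
  f≡ : f p k (+ x) ≡ fin (E + v)
  f≡ = trans (f-nat k x pp k≤x) (cong fin (trans (cong (valℕ p) (falling≡ x k)) (val-* pp (1≤n! k) 1≤C)))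

-- Truncating every valuation at a level R ≥ 2 e_p(k) does not affect the
-- condition f_{p,k}(n) ≥ 2 e_p(k), and a truncated valuation min(ν_p(z), R) depends only on
-- z mod p^R.  Hence the condition is invariant under shifts by multiples of p^R, which lets us
-- reduce integer arguments to natural ones.

Periodic : ℕ → (ℤ → Set) → Set
Periodic d P = ∀ n n′ → + d ℤD.∣ (n ℤ.- n′) → P n → P n′

∣-− : ∀ {d m n} → d ℤD.∣ m → d ℤD.∣ n → d ℤD.∣ (m ℤ.- n)
∣-− {d} {m} {n} d∣m d∣n =
  ∣⇒∣ᵤ {d} {m ℤ.- n} (ℤS.∣m∣n⇒∣m-n {d} {m} {n} (∣ᵤ⇒∣ {d} {m} d∣m) (∣ᵤ⇒∣ {d} {n} d∣n))

∣-swap : ∀ {d} m n → d ℤD.∣ (m ℤ.- n) → d ℤD.∣ (n ℤ.- m)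
∣-swap {d} m n d∣m−n = subst (d ℤD.∣_) (negate m n) (∣-− {d} {ℤ.0ℤ} {m ℤ.- n} (divides 0 refl) d∣m−n)
  where
  negate : ∀ m n → ℤ.0ℤ ℤ.- (m ℤ.- n) ≡ n ℤ.- m
  negate = ℤSolver.solve-∀

trunc : ℕ → ℕ∞ → ℕ
trunc R (fin a) = a ⊓ R
trunc R ∞       = R

trunc≤ : ∀ R A → trunc R A ≤ R
trunc≤ R (fin a) = m⊓n≤n a R
trunc≤ R ∞       = ≤-refl

trunc-≥∞ : ∀ R A {c} → c ≤ R → A ≥∞ c ⇔ c ≤ trunc R A
trunc-≥∞ R (fin a) c≤R = mk⇔ (λ c≤a → ⊓-glb c≤a c≤R) (λ c≤a⊓R → ≤-trans c≤a⊓R (m⊓n≤m a R))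
trunc-≥∞ R ∞       c≤R = mk⇔ (λ _ → c≤R) (λ _ → tt)

⊓-+ : ∀ a b R → (a + b) ⊓ R ≡ (a ⊓ R + b ⊓ R) ⊓ R
⊓-+ a b R with ≤-total a R | ≤-total b R
... | inj₁ a≤R | inj₁ b≤R = cong (_⊓ R) (sym (cong₂ _+_ (m≤n⇒m⊓n≡m a≤R) (m≤n⇒m⊓n≡m b≤R)))
... | inj₂ R≤a | _ = trans (m≥n⇒m⊓n≡n (≤-trans R≤a (m≤m+n a b)))
  (sym (m≥n⇒m⊓n≡n (≤-trans (≤-reflexive (sym (m≥n⇒m⊓n≡n R≤a))) (m≤m+n (a ⊓ R) (b ⊓ R)))))
... | _ | inj₂ R≤b = trans (m≥n⇒m⊓n≡n (≤-trans R≤b (m≤n+m b a)))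
  (sym (m≥n⇒m⊓n≡n (≤-trans (≤-reflexive (sym (m≥n⇒m⊓n≡n R≤b))) (m≤n+m (b ⊓ R) (a ⊓ R)))))

trunc-+∞ : ∀ R A B → trunc R (A +∞ B) ≡ (trunc R A + trunc R B) ⊓ R
trunc-+∞ R (fin a) (fin b) = ⊓-+ a b R
trunc-+∞ R (fin a) ∞       = sym (m≥n⇒m⊓n≡n (m≤n+m R (a ⊓ R)))
trunc-+∞ R ∞       B       = sym (m≥n⇒m⊓n≡n (m≤m+n R (trunc R B)))

trunc-ν-∣ : ∀ {p} R z {r} → Prime p → r ≤ R → r ≤ trunc R (ν p z) ⇔ p ^ r ∣ ∣ z ∣
trunc-ν-∣ R (+ zero) pp r≤R = mk⇔ (λ _ → divides 0 refl) (λ _ → r≤R)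
trunc-ν-∣ R (+ suc m) pp r≤R =
  mk⇔ (λ r≤ → val-∣⇐ (prime≥2 pp) (s≤s z≤n) (≤-trans r≤ (m⊓n≤m _ R)))
      (λ pʳ∣ → ⊓-glb (val-∣⇒ pp (s≤s z≤n) pʳ∣) r≤R)
trunc-ν-∣ R ℤ.-[1+ m ] pp r≤R = trunc-ν-∣ R (+ suc m) pp r≤R

trunc-ν-≤ : ∀ {p} R z z′ → Prime p → + (p ^ R) ℤD.∣ (z ℤ.- z′) → trunc R (ν p z) ≤ trunc R (ν p z′)
trunc-ν-≤ {p} R z z′ pp pᴿ∣ = from (trunc-ν-∣ R z′ pp t≤R) (subst (+ (p ^ t) ℤD.∣_) (cancel z z′) pᵗ∣z′)
  where
  t = trunc R (ν p z)
  t≤R : t ≤ R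
  t≤R = trunc≤ R (ν p z)
  pᵗ∣z′ : + (p ^ t) ℤD.∣ (z ℤ.- (z ℤ.- z′))
  pᵗ∣z′ = ∣-− {+ (p ^ t)} {z} {z ℤ.- z′} (to (trunc-ν-∣ R z pp t≤R) ≤-refl) (∣-trans (pow∣pow p t≤R) pᴿ∣)
  cancel : ∀ z z′ → z ℤ.- (z ℤ.- z′) ≡ z′
  cancel = ℤSolver.solve-∀

trunc-ν-cong : ∀ {p} R z z′ → Prime p → + (p ^ R) ℤD.∣ (z ℤ.- z′) → trunc R (ν p z) ≡ trunc R (ν p z′)
trunc-ν-cong {p} R z z′ pp pᴿ∣ =
  ≤-antisym (trunc-ν-≤ R z z′ pp pᴿ∣) (trunc-ν-≤ R z′ z pp (∣-swap {+ (p ^ R)} z z′ pᴿ∣))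

trunc-f-cong : ∀ {p} R k n n′ → Prime p → + (p ^ R) ℤD.∣ (n ℤ.- n′) → trunc R (f p k n) ≡ trunc R (f p k n′)
trunc-f-cong R zero    n n′ pp pᴿ∣ = refl
trunc-f-cong {p} R (suc k) n n′ pp pᴿ∣ = begin
  trunc R (f p k n +∞ ν p (n ℤ.- + k))                   ≡⟨ trunc-+∞ R (f p k n) _ ⟩
  (trunc R (f p k n) + trunc R (ν p (n ℤ.- + k))) ⊓ R    ≡⟨ cong₂ (λ s t → (s + t) ⊓ R)
                                                               (trunc-f-cong R k n n′ pp pᴿ∣) last-factor ⟩
  (trunc R (f p k n′) + trunc R (ν p (n′ ℤ.- + k))) ⊓ R  ≡⟨ sym (trunc-+∞ R (f p k n′) _) ⟩
  trunc R (f p k n′ +∞ ν p (n′ ℤ.- + k))                 ∎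
  where
  open ≡-Reasoning
  shift : ∀ n n′ j → (n ℤ.- j) ℤ.- (n′ ℤ.- j) ≡ n ℤ.- n′
  shift = ℤSolver.solve-∀
  last-factor : trunc R (ν p (n ℤ.- + k)) ≡ trunc R (ν p (n′ ℤ.- + k))
  last-factor = trunc-ν-cong R (n ℤ.- + k) (n′ ℤ.- + k) pp (subst (+ (p ^ R) ℤD.∣_) (sym (shift n n′ (+ k))) pᴿ∣)

cond-periodic : ∀ {p} k R → Prime p → 2 * e p k ≤ R → Periodic (p ^ R) (Cond p k)
cond-periodic {p} k R pp 2E≤R n n′ pᴿ∣ c =
  from (trunc-≥∞ R (f p k n′) 2E≤R)
    (subst (2 * e p k ≤_) (trunc-f-cong R k n n′ pp pᴿ∣) (to (trunc-≥∞ R (f p k n) 2E≤R) c))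

-- A property of integers that is D-periodic is d-periodic, for d ∣ D, as soon as it is
-- d-periodic on the natural numbers: compare the residues modulo D.
periodic-from-ℕ : ∀ {P : ℤ → Set} d D .{{_ : NonZero D}} → d ∣ D → Periodic D P →
                  (∀ r r′ → d ∣ ∣ + r ℤ.- + r′ ∣ → P (+ r) → P (+ r′)) → Periodic d P
periodic-from-ℕ {P} d D d∣D D-periodic ℕ-periodic n n′ d∣n−n′ Pn =
  D-periodic (+ r′) n′ (∣-swap {+ D} n′ (+ r′) (residue n′))
    (ℕ-periodic r r′ d∣r−r′ (D-periodic n (+ r) (residue n) Pn))
  where
  r = n ℤ.%ℕ D
  r′ = n′ ℤ.%ℕ D
  residue : ∀ n → + D ℤD.∣ (n ℤ.- + (n ℤ.%ℕ D))
  residue n = ∣⇒∣ᵤ {+ D} (ℤS.divides (n ℤ./ℕ D)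
    (trans (cong (ℤ._- + (n ℤ.%ℕ D)) (a≡a%ℕn+[a/ℕn]*n n D)) (cancel (+ (n ℤ.%ℕ D)) ((n ℤ./ℕ D) ℤ.* + D))))
    where
    cancel : ∀ a b → (a ℤ.+ b) ℤ.- a ≡ b
    cancel = ℤSolver.solve-∀
  d∣r−r′ : + d ℤD.∣ (+ r ℤ.- + r′)
  d∣r−r′ = subst (+ d ℤD.∣_) (regroup n n′ (+ r) (+ r′))
    (∣-− {+ d} {n ℤ.- n′} d∣n−n′ (∣-− {+ d} {n ℤ.- + r} (∣-trans d∣D (residue n)) (∣-trans d∣D (residue n′))))
    where
    regroup : ∀ a b c d → (a ℤ.- b) ℤ.- ((a ℤ.- c) ℤ.- (b ℤ.- d)) ≡ c ℤ.- d
    regroup = ℤSolver.solve-∀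

-- Periodicity is symmetric, so a period in our one-directional sense is one in the sense of Defs.
periodic⇒DependsMod : ∀ {p k m} → Periodic (p ^ m) (Cond p k) → DependsMod p k m
periodic⇒DependsMod {p} {k} {m} periodic n n′ pᵐ∣ =
  mk⇔ (periodic n n′ pᵐ∣) (periodic n′ n (∣-swap {+ (p ^ m)} n n′ pᵐ∣))

lg : ℕ → ℕ → ℕ
lg p zero = 0
lg p (suc k) with p ^ suc (lg p k) ≤? suc k
... | yes _ = suc (lg p k)
... | no  _ = lg p k

lg-spec : ∀ {p} k → 2 ≤ p → (k < p ^ suc (lg p k)) × (1 ≤ k → p ^ lg p k ≤ k)
lg-spec {p} zero 2≤p = pow≥1 p 1 (≥2⇒≥1 2≤p) , λ ()
lg-spec {p} (suc k) 2≤p with lg-spec {p} k 2≤p | p ^ suc (lg p k) ≤? suc k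
... | k<pᴸ⁺¹ , _ | yes pᴸ⁺¹≤ = <-≤-trans (s≤s k<pᴸ⁺¹) pᴸ⁺¹<pᴸ⁺² , λ _ → pᴸ⁺¹≤
  where
  pᴸ⁺¹<pᴸ⁺² : p ^ suc (lg p k) < p ^ suc (suc (lg p k))
  pᴸ⁺¹<pᴸ⁺² = ≤-trans (m<m*n _ p {{m^n≢0 p (suc (lg p k)) {{>-nonZero (≥2⇒≥1 2≤p)}}}} 2≤p) (≤-reflexive (*-comm _ p))
... | _ , pᴸ≤ | no pᴸ⁺¹≰ = ≰⇒> pᴸ⁺¹≰ , λ _ → lg-step k pᴸ≤
  where
  lg-step : ∀ k → (1 ≤ k → p ^ lg p k ≤ k) → p ^ lg p k ≤ suc k
  lg-step zero    _   = ≤-refl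
  lg-step (suc k) pᴸ≤ = m≤n⇒m≤1+n (pᴸ≤ (s≤s z≤n))

-- Upper bound: the condition is p^(e_p(k) + L)-periodic, where k < p^(L+1).

∣-cancel-val : ∀ {p E L} i B → Prime p → 1 ≤ i → valℕ p i ≤ L → p ^ (E + L) ∣ i * B → p ^ E ∣ B
∣-cancel-val         i zero    pp 1≤i νi≤L _ = divides 0 refl
∣-cancel-val {p} {E} {L} i (suc B) pp 1≤i νi≤L pᴱ⁺ᴸ∣ =
  val-∣⇐ (prime≥2 pp) (s≤s z≤n) (+-cancelʳ-≤ L E (valℕ p (suc B)) E+L≤)
  where
  E+L≤ : E + L ≤ valℕ p (suc B) + L
  E+L≤ = begin
    E + L                         ≤⟨ val-∣⇒ pp (*-mono-≤ 1≤i (s≤s z≤n)) pᴱ⁺ᴸ∣ ⟩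
    valℕ p (i * suc B)            ≡⟨ val-* pp 1≤i (s≤s z≤n) ⟩
    valℕ p i + valℕ p (suc B)     ≤⟨ +-monoˡ-≤ _ νi≤L ⟩
    L + valℕ p (suc B)            ≡⟨ +-comm L _ ⟩
    valℕ p (suc B) + L            ∎
    where open ≤-Reasoning

-- If p^(E+L) ∣ h then p^E ∣ C(h,i) for 1 ≤ i < p^(L+1), by absorption i C(h,i) = h C(h-1,i-1).
choose-divisible : ∀ {p E L} h → Prime p → p ^ (E + L) ∣ h → ∀ i → 1 ≤ i → i < p ^ suc L → p ^ E ∣ choose h i
choose-divisible zero    pp _   (suc i) _ _ = divides 0 refl
choose-divisible {p} {E} {L} (suc h) pp pᴱ⁺ᴸ∣h (suc i) 1≤i i<pᴸ⁺¹ =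
  ∣-cancel-val {p} {E} {L} (suc i) _ pp 1≤i (≤-pred (val-< (prime≥2 pp) 1≤i i<pᴸ⁺¹))
    (subst (p ^ (E + L) ∣_) (sym (absorption h i)) (∣m⇒∣m*n (choose h i) pᴱ⁺ᴸ∣h))

cond-shift : ∀ {p k L} → Prime p → k < p ^ suc L → ∀ x h → p ^ (e p k + L) ∣ h →
             Cond p k (+ x) ⇔ Cond p k (+ (x + h))
cond-shift {p} {k} {L} pp k<pᴸ⁺¹ x h pᴹ∣h = mk⇔
  (λ c → from (cond-nat k (x + h) pp) (m%n≡0⇒n∣m _ _ (trans shifted (n∣m⇒m%n≡0 _ _ (to (cond-nat k x pp) c)))))
  (λ c → from (cond-nat k x pp) (m%n≡0⇒n∣m _ _ (trans (sym shifted) (n∣m⇒m%n≡0 _ _ (to (cond-nat k (x + h) pp) c)))))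
  where
  instance
    pᴱ≢0 : NonZero (p ^ e p k)
    pᴱ≢0 = m^n≢0 p (e p k) {{prime⇒nonZero pp}}
  shifted : choose (x + h) k % p ^ e p k ≡ choose x k % p ^ e p k
  shifted = choose-shift (p ^ e p k) h k
    (λ i 1≤i i≤k → choose-divisible {p} {e p k} {L} h pp pᴹ∣h i 1≤i (≤-<-trans i≤k k<pᴸ⁺¹)) x k ≤-refl

cond-ℕ-periodic : ∀ {p k L} → Prime p → k < p ^ suc L → ∀ r r′ →
                  p ^ (e p k + L) ∣ ∣ + r ℤ.- + r′ ∣ → Cond p k (+ r) → Cond p k (+ r′)
cond-ℕ-periodic {p} {k} pp k<pᴸ⁺¹ r r′ pᴹ∣ with ≤-total r r′
... | inj₁ r≤r′ = subst (λ t → Cond p k (+ r) → Cond p k (+ t)) (m+[n∸m]≡n r≤r′)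
                    (to (cond-shift pp k<pᴸ⁺¹ r (r′ ∸ r) (subst (_ ∣_) (∣+r−+r′∣ r≤r′) pᴹ∣)))
  where
  ∣+r−+r′∣ : r ≤ r′ → ∣ + r ℤ.- + r′ ∣ ≡ r′ ∸ r
  ∣+r−+r′∣ r≤r′ = trans (cong ∣_∣ (ℤP.[+m]-[+n]≡m⊖n r r′))
                   (trans (ℤP.∣m⊖n∣≡∣n⊖m∣ r r′) (cong ∣_∣ (ℤP.⊖-≥ r≤r′)))
... | inj₂ r′≤r = subst (λ t → Cond p k (+ t) → Cond p k (+ r′)) (m+[n∸m]≡n r′≤r)
                    (from (cond-shift pp k<pᴸ⁺¹ r′ (r ∸ r′) (subst (_ ∣_) (cong ∣_∣ (+-minus-+ r r′ r′≤r)) pᴹ∣)))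

-- The period p^(e_p(k)+L), hence a_p(k) ≤ e_p(k) + L: it is a period on ℕ, and the coarse
-- period p^(e_p(k)+L+2e_p(k)) is a multiple of it.
upper-period : ∀ {p k L} → Prime p → k < p ^ suc L → DependsMod p k (e p k + L)
upper-period {p} {k} {L} pp k<pᴸ⁺¹ = periodic⇒DependsMod {p} {k} {M}
  (periodic-from-ℕ {Cond p k} (p ^ M) (p ^ (M + 2 * E)) {{m^n≢0 p (M + 2 * E) {{prime⇒nonZero pp}}}}
    (pow∣pow p (m≤m+n M (2 * E))) (cond-periodic k (M + 2 * E) pp (m≤n+m (2 * E) M))
    (cond-ℕ-periodic {p} {k} {L} pp k<pᴸ⁺¹))
  where
  E = e p k
  M = E + L

-- Lower bound: for L < m < e_p(k) the modulus p^m is not a period, witnessed by k-1 and p^m+k-1.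

val-falling-shift : ∀ {p m} → Prime p → ∀ j → j < p ^ m → valℕ p (falling (p ^ m + j) (suc j)) ≡ m + valℕ p (j !)
val-falling-shift {p} {m} pp zero _ = begin
  valℕ p ((p ^ m + 0) * 1)  ≡⟨ cong (valℕ p) (trans (*-identityʳ (p ^ m + 0)) (+-identityʳ (p ^ m))) ⟩
  valℕ p (p ^ m)            ≡⟨ val-pow m 2≤p ⟩
  m                         ≡⟨ sym (trans (cong (_+_ m) (val-1 2≤p)) (+-identityʳ m)) ⟩
  m + valℕ p 1              ∎
  where
  open ≡-Reasoning
  2≤p = prime≥2 pp
val-falling-shift {p} {m} pp (suc j) j<pᵐ = begin
  valℕ p ((p ^ m + suc j) * falling (pred (p ^ m + suc j)) (suc j))
    ≡⟨ cong (λ t → valℕ p ((p ^ m + suc j) * falling (pred t) (suc j))) (+-suc (p ^ m) j) ⟩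
  valℕ p ((p ^ m + suc j) * falling (p ^ m + j) (suc j))
    ≡⟨ val-* pp (≤-trans (s≤s z≤n) (m≤n+m (suc j) (p ^ m)))
                (falling≥1 _ (suc j) (+-monoˡ-≤ j (pow≥1 p m (≥2⇒≥1 2≤p)))) ⟩
  valℕ p (p ^ m + suc j) + valℕ p (falling (p ^ m + j) (suc j))
    ≡⟨ cong₂ _+_ (val-shift {p} {m} 2≤p (s≤s z≤n) j<pᵐ) (val-falling-shift pp j (<-trans (n<1+n j) j<pᵐ)) ⟩
  valℕ p (suc j) + (m + valℕ p (j !))
    ≡⟨ swap (valℕ p (suc j)) m _ ⟩
  m + (valℕ p (suc j) + valℕ p (j !))
    ≡⟨ cong (_+_ m) (sym (val-* pp (s≤s z≤n) (1≤n! j))) ⟩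
  m + valℕ p (suc j !) ∎
  where
  open ≡-Reasoning
  2≤p = prime≥2 pp
  swap : ∀ x y z → x + (y + z) ≡ y + (x + z)
  swap = solve-∀

not-period : ∀ {p k′ m} → Prime p → k′ < p ^ m → m < e p (suc k′) → ¬ DependsMod p (suc k′) m
not-period {p} {k′} {m} pp k′<pᵐ m<E period = <-irrefl refl (<-≤-trans m+E<2E 2E≤m+E)
  where
  E = e p (suc k′)
  x = p ^ m + k′
  x−k′ : + x ℤ.- + k′ ≡ + (p ^ m)
  x−k′ = trans (+-minus-+ x k′ (m≤n+m k′ (p ^ m))) (cong +_ (m+n∸n≡m (p ^ m) k′))
  -- C(k′, k′+1) = 0, so the condition holds trivially at k′ ...
  cond-k′ : Cond p (suc k′) (+ k′)
  cond-k′ = from (cond-nat (suc k′) k′ pp) (subst (p ^ E ∣_) (sym (choose-< k′ (suc k′) (n<1+n k′))) (divides 0 refl))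
  -- ... and would transfer to x = p^m + k′, where f_{p,k}(x) = m + ν_p(k′!) ≤ m + E < 2E.
  cond-x : Cond p (suc k′) (+ x)
  cond-x = from (period (+ x) (+ k′) (subst (λ z → p ^ m ∣ ∣ z ∣) (sym x−k′) ∣-refl)) cond-k′
  2E≤m+E : 2 * E ≤ m + E
  2E≤m+E = begin
    2 * E                         ≤⟨ subst (_≥∞ (2 * E)) (f-nat (suc k′) x pp k≤x) cond-x ⟩
    valℕ p (falling x (suc k′))   ≡⟨ val-falling-shift pp k′ k′<pᵐ ⟩
    m + valℕ p (k′ !)             ≤⟨ +-monoʳ-≤ m ν[k′!]≤E ⟩
    m + E                         ∎
    where
    open ≤-Reasoning
    k≤x : suc k′ ≤ x
    k≤x = +-monoˡ-≤ k′ (pow≥1 p m (≥2⇒≥1 (prime≥2 pp)))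
    ν[k′!]≤E : valℕ p (k′ !) ≤ E
    ν[k′!]≤E = subst (valℕ p (k′ !) ≤_) (sym (val-* {p} {suc k′} pp (s≤s z≤n) (1≤n! k′))) (m≤n+m _ _)
  m+E<2E : m + E < 2 * E
  m+E<2E = subst (m + E <_) (sym (2*≡ E)) (+-monoˡ-< E m<E)

a-bounds : ∀ {p k a} → Prime p → p ≤ k → Least (DependsMod p k) a →
           (a ≤ e p k + lg p k) × (e p k ≤ a + suc (lg p k))
a-bounds {p} {zero} pp p≤0 _ = ⊥-elim (<-irrefl refl (≤-trans (≥2⇒≥1 (prime≥2 pp)) p≤0))
a-bounds {p} {suc k′} {a} pp _ (period-a , least) = least _ (upper-period pp k<pᴸ⁺¹) , lower
  where
  L = lg p (suc k′)
  k<pᴸ⁺¹ = proj₁ (lg-spec (suc k′) (prime≥2 pp))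
  -- otherwise m = a + L + 1 would be a period strictly between L and e_p(k)
  lower : e p (suc k′) ≤ a + suc L
  lower with e p (suc k′) ≤? a + suc L
  ... | yes E≤ = E≤
  ... | no E≰ = ⊥-elim (not-period pp k′<pᵐ (≰⇒> E≰)
                  (λ n n′ pᵐ∣ → period-a n n′ (∣-trans (pow∣pow p (m≤m+n a (suc L))) pᵐ∣)))
    where
    k′<pᵐ : k′ < p ^ (a + suc L)
    k′<pᵐ = <-≤-trans (<-trans (n<1+n k′) k<pᴸ⁺¹) (^-monoʳ-≤ p {{prime⇒nonZero pp}} (m≤n+m (suc L) a))

prod : (ℕ → ℕ) → ℕ → ℕ
prod g zero    = 1
prod g (suc n) = prod g n * g n

prod-list : ∀ g n → product (map g (upTo n)) ≡ prod g n
prod-list g zero    = refl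
prod-list g (suc n) = begin
  product (map g (upTo (suc n)))            ≡⟨ cong (λ l → product (map g l)) (sym (upTo-∷ʳ n)) ⟩
  product (map g (upTo n ++ n ∷ []))        ≡⟨ cong product (map-++ g (upTo n) (n ∷ [])) ⟩
  product (map g (upTo n) ++ g n ∷ [])      ≡⟨ product-++ (map g (upTo n)) (g n ∷ []) ⟩
  product (map g (upTo n)) * (g n * 1)      ≡⟨ cong₂ _*_ (prod-list g n) (*-identityʳ (g n)) ⟩
  prod g n * g n                            ∎
  where open ≡-Reasoning

prod-mono : ∀ {g h} n → (∀ i → i < n → g i ≤ h i) → prod g n ≤ prod h n
prod-mono zero    g≤h = ≤-refl
prod-mono (suc n) g≤h = *-mono-≤ (prod-mono n (λ i i<n → g≤h i (m≤n⇒m≤1+n i<n))) (g≤h n ≤-refl)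

prod-cong : ∀ {g h} n → (∀ i → i < n → g i ≡ h i) → prod g n ≡ prod h n
prod-cong n g≡h = ≤-antisym (prod-mono n (λ i i<n → ≤-reflexive (g≡h i i<n)))
                            (prod-mono n (λ i i<n → ≤-reflexive (sym (g≡h i i<n))))

prod-* : ∀ g h n → prod (λ i → g i * h i) n ≡ prod g n * prod h n
prod-* g h zero    = refl
prod-* g h (suc n) = trans (cong (_* (g n * h n)) (prod-* g h n)) (interchange (prod g n) (prod h n) (g n) (h n))
  where
  interchange : ∀ a b c d → a * b * (c * d) ≡ a * c * (b * d)
  interchange = solve-∀

prod-split : ∀ g a b → prod g (a + b) ≡ prod g a * prod (λ i → g (a + i)) b
prod-split g a zero    = trans (cong (prod g) (+-identityʳ a)) (sym (*-identityʳ (prod g a)))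
prod-split g a (suc b) = begin
  prod g (a + suc b)                              ≡⟨ cong (prod g) (+-suc a b) ⟩
  prod g (a + b) * g (a + b)                      ≡⟨ cong (_* g (a + b)) (prod-split g a b) ⟩
  prod g a * prod (λ i → g (a + i)) b * g (a + b) ≡⟨ *-assoc (prod g a) _ _ ⟩
  prod g a * (prod (λ i → g (a + i)) b * g (a + b)) ∎
  where open ≡-Reasoning

prod-ones : ∀ g n → (∀ i → i < n → g i ≡ 1) → prod g n ≡ 1
prod-ones g zero    _    = refl
prod-ones g (suc n) ones = cong₂ _*_ (prod-ones g n (λ i i<n → ones i (m≤n⇒m≤1+n i<n))) (ones n ≤-refl)

prod-single : ∀ g n j → j < n → (∀ i → i < n → i ≢ j → g i ≡ 1) → prod g n ≡ g j
prod-single g (suc n) j j≤n others with m≤n⇒m<n∨m≡n (≤-pred j≤n)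
... | inj₁ j<n  = trans (cong₂ _*_ (prod-single g n j j<n (λ i i<n → others i (m≤n⇒m≤1+n i<n)))
                                   (others n ≤-refl (λ n≡j → <-irrefl (sym n≡j) j<n))) (*-identityʳ (g j))
... | inj₂ refl = trans (cong (_* g j) (prod-ones g j (λ i i<j → others i (m≤n⇒m≤1+n i<j) (<⇒≢ i<j)))) (*-identityˡ (g j))

atPrime : ℕ → ℕ → ℕ
atPrime i x = if does (prime? i) then x else 1

atPrime-mono : ∀ i {x y} → (Prime i → x ≤ y) → atPrime i x ≤ atPrime i y
atPrime-mono i x≤y with prime? i
... | yes pi = x≤y pi
... | no  _  = ≤-refl

atPrime-* : ∀ i x y → atPrime i (x * y) ≡ atPrime i x * atPrime i y
atPrime-* i x y with prime? i
... | yes _ = refl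
... | no  _ = refl

atPrime-1 : ∀ i {x} → (Prime i → x ≡ 1) → atPrime i x ≡ 1
atPrime-1 i x≡1 with prime? i
... | yes pi = x≡1 pi
... | no  _  = refl

primeProd : (ℕ → ℕ) → ℕ → ℕ
primeProd g n = prod (λ i → atPrime i (g i)) (suc n)

m′≡primeProd : ∀ a k → m′ a k ≡ primeProd (λ p → p ^ a p k) k
m′≡primeProd a k = prod-list (λ i → atPrime i (i ^ a i k)) (suc k)

primeProd-mono : ∀ {g h} n → (∀ p → p ≤ n → Prime p → g p ≤ h p) → primeProd g n ≤ primeProd h n
primeProd-mono n g≤h = prod-mono (suc n) (λ i i≤n → atPrime-mono i (g≤h i (≤-pred i≤n)))

primeProd-cong : ∀ {g h} n → (∀ p → p ≤ n → Prime p → g p ≡ h p) → primeProd g n ≡ primeProd h n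
primeProd-cong n g≡h = ≤-antisym (primeProd-mono n (λ p p≤n pp → ≤-reflexive (g≡h p p≤n pp)))
                                 (primeProd-mono n (λ p p≤n pp → ≤-reflexive (sym (g≡h p p≤n pp))))

primeProd-* : ∀ g h n → primeProd (λ p → g p * h p) n ≡ primeProd g n * primeProd h n
primeProd-* g h n = trans (prod-cong (suc n) (λ i _ → atPrime-* i (g i) (h i)))
                          (prod-* (λ i → atPrime i (g i)) (λ i → atPrime i (h i)) (suc n))

-- Unique factorisation in the form needed here: ∏_{p ≤ M} p^ν_p(N) = N when all prime factors
-- of N are at most M; in particular ∏_{p ≤ k} p^e_p(k) = k!.

prime-∣-prime : ∀ {p q} → Prime p → Prime q → p ∣ q → p ≡ q
prime-∣-prime pp pq p∣q with prime⇒irreducible pq p∣q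
... | inj₁ p≡1 = ⊥-elim (<-irrefl (sym p≡1) (prime≥2 pp))
... | inj₂ p≡q = p≡q

smoothPart : ℕ → ℕ → ℕ
smoothPart M N = primeProd (λ p → p ^ valℕ p N) M

smoothPart-* : ∀ M a b → 1 ≤ a → 1 ≤ b → smoothPart M (a * b) ≡ smoothPart M a * smoothPart M b
smoothPart-* M a b 1≤a 1≤b =
  trans (primeProd-cong M (λ p _ pp → trans (cong (p ^_) (val-* pp 1≤a 1≤b)) (^-distribˡ-+-* p (valℕ p a) (valℕ p b))))
        (primeProd-* (λ p → p ^ valℕ p a) (λ p → p ^ valℕ p b) M)

smoothPart-1 : ∀ M → smoothPart M 1 ≡ 1
smoothPart-1 M = prod-ones _ (suc M) (λ i _ → atPrime-1 i (λ pi → cong (i ^_) (val-1 (prime≥2 pi))))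

-- For a prime q ≤ M only the factor at p = q differs from 1.
smoothPart-prime : ∀ M q → Prime q → q ≤ M → smoothPart M q ≡ q
smoothPart-prime M q pq q≤M = trans (prod-single _ (suc M) q (s≤s q≤M) others) at-q
  where
  others : ∀ i → i < suc M → i ≢ q → atPrime i (i ^ valℕ i q) ≡ 1
  others i _ i≢q = atPrime-1 i (λ pi → cong (i ^_)
    (val-unique {i} {q} {0} {q} (prime≥2 pi) (sym (*-identityˡ q)) (λ i∣q → i≢q (prime-∣-prime pi pq i∣q))))
  at-q : atPrime q (q ^ valℕ q q) ≡ q
  at-q with prime? q
  ... | yes _   = trans (cong (q ^_) νq[q]≡1) (*-identityʳ q)
    where
    νq[q]≡1 : valℕ q q ≡ 1
    νq[q]≡1 = val-unique {q} {q} {1} {1} (prime≥2 pq) (sym (trans (*-identityʳ (q * 1)) (*-identityʳ q))) (p∤1 (prime≥2 pq))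
  ... | no ¬pq  = ⊥-elim (¬pq pq)

-- By strong induction: N is 1, a prime, or a product of two smaller factors.
smoothPart-id : ∀ M N → 1 ≤ N → N ≤ M → smoothPart M N ≡ N
smoothPart-id M = <-rec P step
  where
  P : ℕ → Set
  P N = 1 ≤ N → N ≤ M → smoothPart M N ≡ N
  step : ∀ N → (∀ {N′} → N′ < N → P N′) → P N
  step (suc zero) _ _ _ = smoothPart-1 M
  step N@(suc (suc _)) rec _ N≤M with composite? N
  ... | no ¬composite = smoothPart-prime M N (prime ¬composite) N≤M
  ... | yes (composite {d} d<N (divides c N≡cd)) = begin
    smoothPart M N                     ≡⟨ cong (smoothPart M) N≡cd ⟩
    smoothPart M (c * d)               ≡⟨ smoothPart-* M c d 1≤c 1≤d ⟩
    smoothPart M c * smoothPart M d    ≡⟨ cong₂ _*_ (rec c<N 1≤c (≤-trans (<⇒≤ c<N) N≤M))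
                                                    (rec d<N 1≤d (≤-trans (<⇒≤ d<N) N≤M)) ⟩
    c * d                              ≡⟨ sym N≡cd ⟩
    N                                  ∎
    where
    open ≡-Reasoning
    1≤c = factor≥1 (s≤s z≤n) N≡cd
    1≤d = ≤-trans (s≤s z≤n) (nonTrivial⇒n>1 d)
    c<N : c < N
    c<N = ≤-trans (m<m*n c d {{>-nonZero 1≤c}} (nonTrivial⇒n>1 d)) (≤-reflexive (sym N≡cd))

smoothPart-! : ∀ M k → k ≤ M → smoothPart M (k !) ≡ k !
smoothPart-! M zero    _   = smoothPart-1 M
smoothPart-! M (suc k) k<M = trans (smoothPart-* M (suc k) (k !) (s≤s z≤n) (1≤n! k))
  (cong₂ _*_ (smoothPart-id M (suc k) (s≤s z≤n) k<M) (smoothPart-! M k (<⇒≤ k<M)))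

-- Chebyshev's bound ∏_{p ≤ n} p ≤ 8^n.  The primes in (m+1, 2m+1] divide C(2m+1, m) ≤ 2^(2m+1),
-- which gives the recursion primorial(2m+1) ≤ primorial(m+1) · 8^m.

primorial : ℕ → ℕ
primorial n = primeProd (λ p → p) n

falling-∣ : ∀ k n q → q ≤ n → n < q + k → q ∣ falling n k
falling-∣ zero    n q q≤n n<q = ⊥-elim (<-irrefl refl (≤-trans (subst (n <_) (+-identityʳ q) n<q) q≤n))
falling-∣ (suc k) n q q≤n n<q+k with m≤n⇒m<n∨m≡n q≤n
... | inj₂ refl = m∣m*n (falling (pred q) k)
falling-∣ (suc k) (suc n) q q≤n n<q+k | inj₁ q<n =
  ∣n⇒∣m*n (suc n) (falling-∣ k n q (≤-pred q<n) (≤-pred (subst (suc (suc n) ≤_) (+-suc q k) n<q+k)))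

prime-∣-! : ∀ {q} j → Prime q → q ∣ j ! → q ≤ j
prime-∣-! zero    pq q∣1 = ⊥-elim (p∤1 (prime≥2 pq) q∣1)
prime-∣-! (suc j) pq q∣j! with euclidsLemma (suc j) (j !) pq q∣j!
... | inj₁ q∣j+1 = ∣⇒≤ q∣j+1
... | inj₂ q∣j!  = m≤n⇒m≤1+n (prime-∣-! j pq q∣j!)

-- Every prime q with m + 2 ≤ q ≤ 2m + 1 divides C(2m+1, m): it divides
-- (2m+1) ⋯ (m+2) = m! C(2m+1, m) but not m!.
prime-∣-central : ∀ {q} m → Prime q → 2 + m ≤ q → q ≤ suc (m + m) → q ∣ choose (suc (m + m)) m
prime-∣-central {q} m pq 2+m≤q q≤2m+1
  with euclidsLemma (m !) (choose (suc (m + m)) m) pq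
         (subst (q ∣_) (falling≡ (suc (m + m)) m) (falling-∣ m (suc (m + m)) q q≤2m+1 (+-monoˡ-≤ m 2+m≤q)))
... | inj₁ q∣m! = ⊥-elim (<-irrefl refl (≤-trans 2+m≤q (≤-trans (prime-∣-! m pq q∣m!) (n≤1+n m))))
... | inj₂ q∣C  = q∣C

primesFrom : ℕ → ℕ → ℕ
primesFrom a j = prod (λ i → atPrime (a + i) (a + i)) j

primesFrom-coprime : ∀ a j q → Prime q → a + j ≤ q → ¬ q ∣ primesFrom a j
primesFrom-coprime a zero    q pq _ q∣1 = p∤1 (prime≥2 pq) q∣1
primesFrom-coprime a (suc j) q pq a+j<q q∣ with euclidsLemma (primesFrom a j) (atPrime (a + j) (a + j)) pq q∣
... | inj₁ q∣P = primesFrom-coprime a j q pq (≤-trans (+-monoʳ-≤ a (n≤1+n j)) a+j<q) q∣P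
... | inj₂ q∣g with prime? (a + j)
...   | yes pr = <-irrefl (sym (prime-∣-prime pq pr q∣g)) (subst (_≤ q) (+-suc a j) a+j<q)
...   | no  _  = p∤1 (prime≥2 pq) q∣g

primesFrom-∣ : ∀ X a j → (∀ q → Prime q → a ≤ q → q < a + j → q ∣ X) → primesFrom a j ∣ X
primesFrom-∣ X a zero    _    = divides X (sym (*-identityʳ X))
primesFrom-∣ X a (suc j) q∣X = extend (primesFrom-∣ X a j (λ q pq a≤q q<a+j → q∣X q pq a≤q (≤-trans q<a+j a+j≤)))
  where
  a+j≤ : a + j ≤ a + suc j
  a+j≤ = +-monoʳ-≤ a (n≤1+n j)
  a+j< : a + j < a + suc j
  a+j< = +-monoʳ-< a (n<1+n j)
  rotate : ∀ x y z → x * y * z ≡ x * (z * y)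
  rotate = solve-∀
  -- X = t P; if a + j is prime it divides t, since it is coprime to P.
  extend : primesFrom a j ∣ X → primesFrom a (suc j) ∣ X
  extend (divides t X≡tP) with prime? (a + j)
  ... | no  _  = divides t (trans X≡tP (cong (t *_) (sym (*-identityʳ (primesFrom a j)))))
  ... | yes pr with euclidsLemma t (primesFrom a j) pr (subst (a + j ∣_) X≡tP (q∣X (a + j) pr (m≤m+n a j) a+j<))
  ...   | inj₂ q∣P = ⊥-elim (primesFrom-coprime a j (a + j) pr ≤-refl q∣P)
  ...   | inj₁ (divides s t≡sq) =
    divides s (trans X≡tP (trans (cong (_* primesFrom a j) t≡sq) (rotate s (a + j) (primesFrom a j))))

primorial-odd : ∀ m → primorial (suc (m + m)) ≡ primorial (suc m) * primesFrom (2 + m) m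
primorial-odd m = prod-split (λ i → atPrime i i) (2 + m) m

primesFrom-central : ∀ m → primesFrom (2 + m) m ≤ 2 ^ suc (m + m)
primesFrom-central m = ≤-trans
  (∣⇒≤ {{>-nonZero (choose-≥1 (suc (m + m)) m (≤-trans (m≤m+n m m) (n≤1+n (m + m))))}}
    (primesFrom-∣ _ (2 + m) m (λ q pq 2+m≤q q<2+m+m → prime-∣-central m pq 2+m≤q (≤-pred q<2+m+m))))
  (choose-≤ (suc (m + m)) m)

-- 2 is the only even prime.
atPrime-even : ∀ m → atPrime (m + m) (m + m) ≤ 2
atPrime-even m with prime? (m + m)
... | yes pr = ≤-reflexive (sym (prime-∣-prime prime[2] pr (divides m (trans (sym (2*≡ m)) (*-comm 2 m)))))
... | no  _  = s≤s z≤n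

data Halving : ℕ → Set where
  even : ∀ m → Halving (m + m)
  odd  : ∀ m → Halving (suc (m + m))

halving : ∀ n → Halving n
halving zero = even 0
halving (suc n) with halving n
... | even m = odd m
... | odd  m = subst Halving (cong suc (+-suc m m)) (even (suc m))

central-≤ : ∀ m → 2 ^ suc (suc m + suc m) ≤ 8 ^ suc m
central-≤ zero    = ≤-refl
central-≤ (suc m) = begin
  2 ^ suc (suc (suc m) + suc (suc m))   ≡⟨ cong (λ t → 2 ^ suc (suc t)) (+-suc (suc m) (suc m)) ⟩
  2 * (2 * 2 ^ suc (suc m + suc m))     ≡⟨ sym (*-assoc 2 2 (2 ^ suc (suc m + suc m))) ⟩
  4 * 2 ^ suc (suc m + suc m)           ≤⟨ *-mono-≤ (m≤m+n 4 4) (central-≤ m) ⟩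
  8 * 8 ^ suc m                         ∎
  where open ≤-Reasoning

primorial-≤ : ∀ n → primorial n ≤ 8 ^ n
primorial-≤ = <-rec (λ n → primorial n ≤ 8 ^ n) step
  where
  open ≤-Reasoning
  step : ∀ n → (∀ {n′} → n′ < n → primorial n′ ≤ 8 ^ n′) → primorial n ≤ 8 ^ n
  step n rec with halving n
  ... | even zero    = ≤-refl
  ... | even (suc m) = begin
    primorial (m + suc m) * atPrime (suc m + suc m) (suc m + suc m)   ≤⟨ *-mono-≤ (rec ≤-refl) (atPrime-even (suc m)) ⟩
    8 ^ (m + suc m) * 2                                               ≤⟨ *-monoʳ-≤ (8 ^ (m + suc m)) (m≤m+n 2 6) ⟩
    8 ^ (m + suc m) * 8                                               ≡⟨ *-comm (8 ^ (m + suc m)) 8 ⟩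
    8 ^ suc (m + suc m)                                               ∎
  ... | odd zero     = s≤s z≤n
  ... | odd (suc m)  = begin
    primorial (suc (suc m + suc m))                      ≡⟨ primorial-odd (suc m) ⟩
    primorial (suc (suc m)) * primesFrom (3 + m) (suc m) ≤⟨ *-mono-≤ (rec (s≤s (s≤s (m≤n+m (suc m) m))))
                                                                      (≤-trans (primesFrom-central (suc m)) (central-≤ m)) ⟩
    8 ^ suc (suc m) * 8 ^ suc m                          ≡⟨ sym (^-distribˡ-+-* 8 (suc (suc m)) (suc m)) ⟩
    8 ^ suc (suc m + suc m)                              ∎

-- The bound Λ(k) = ∏_{p ≤ k} p^⌊log_p k⌋ ≤ 128^k.  With s = ⌊√k⌋, a prime p ≤ s contributes at most
-- k, and a prime p > s contributes p (since p² > k); so Λ(k) ≤ primorial(k) · k^(s+1).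

sqrt-floor : ∀ k → ∃[ s ] (s * s ≤ k) × (k < suc s * suc s)
sqrt-floor zero = 0 , z≤n , s≤s z≤n
sqrt-floor (suc k) with sqrt-floor k
... | s , s²≤k , k<[s+1]² with suc s * suc s ≤? suc k
...   | yes [s+1]²≤ =
  suc s , [s+1]²≤ , ≤-<-trans k<[s+1]² (subst (suc s * suc s <_) (sym (square-step s)) (m<m+n _ (s≤s z≤n)))
  where
  square-step : ∀ s → suc (suc s) * suc (suc s) ≡ suc s * suc s + suc (suc (suc (s + s)))
  square-step = solve-∀
...   | no  [s+1]²≰ = s , ≤-trans s²≤k (n≤1+n k) , ≰⇒> [s+1]²≰

n≤n*n : ∀ n → n ≤ n * n
n≤n*n zero    = z≤n
n≤n*n (suc n) = m≤m*n (suc n) (suc n)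

-- k^(s+1) ≤ 16^k for s = ⌊√k⌋, as s + 1 ≤ 2^s and k < (s+1)² ≤ 4^s.
sqrt-power-≤ : ∀ k s → s * s ≤ k → k < suc s * suc s → k ^ suc s ≤ 16 ^ k
sqrt-power-≤ k s s²≤k k<[s+1]² = begin
  k ^ suc s                   ≤⟨ ^-monoˡ-≤ (suc s) (<⇒≤ k<[s+1]²) ⟩
  (suc s * suc s) ^ suc s     ≤⟨ ^-monoˡ-≤ (suc s) (*-mono-≤ (s<2^s s) (s<2^s s)) ⟩
  (2 ^ s * 2 ^ s) ^ suc s     ≡⟨ cong (_^ suc s) (sym (^-distribˡ-+-* 2 s s)) ⟩
  (2 ^ (s + s)) ^ suc s       ≡⟨ ^-*-assoc 2 (s + s) (suc s) ⟩
  2 ^ ((s + s) * suc s)       ≤⟨ ^-monoʳ-≤ 2 exponent-≤ ⟩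
  2 ^ (4 * k)                 ≡⟨ sym (^-*-assoc 2 4 k) ⟩
  16 ^ k                      ∎
  where
  open ≤-Reasoning
  s<2^s : ∀ s → suc s ≤ 2 ^ s
  s<2^s zero    = ≤-refl
  s<2^s (suc s) = +-mono-≤ (pow≥1 2 s (s≤s z≤n)) (≤-trans (s<2^s s) (≤-reflexive (sym (+-identityʳ (2 ^ s)))))
  s≤k : s ≤ k
  s≤k = ≤-trans (n≤n*n s) s²≤k
  expand : ∀ s → (s + s) * suc s ≡ (s * s + s) + (s * s + s)
  expand = solve-∀
  exponent-≤ : (s + s) * suc s ≤ 4 * k
  exponent-≤ = subst₂ _≤_ (sym (expand s)) (four k) (+-mono-≤ (+-mono-≤ s²≤k s≤k) (+-mono-≤ s²≤k s≤k))
    where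
    four : ∀ k → (k + k) + (k + k) ≡ 4 * k
    four = solve-∀

prod-≤-pow : ∀ {g} c n → (∀ i → i < n → g i ≤ c) → prod g n ≤ c ^ n
prod-≤-pow c zero    _   = ≤-refl
prod-≤-pow c (suc n) g≤c = ≤-trans (*-mono-≤ (prod-≤-pow c n (λ i i<n → g≤c i (m≤n⇒m≤1+n i<n))) (g≤c n ≤-refl))
                                   (≤-reflexive (*-comm (c ^ n) c))

atPrime-≤ : ∀ i {x} → 1 ≤ x → atPrime i x ≤ x
atPrime-≤ i {x} 1≤x with prime? i
... | yes _ = ≤-refl
... | no  _ = 1≤x

weight : ℕ → ℕ → ℕ → ℕ
weight k s i = if i ≤ᵇ s then k else 1

weight-prod-≤ : ∀ k s → 1 ≤ k → s ≤ k → prod (weight k s) (suc k) ≤ k ^ suc s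
weight-prod-≤ k s 1≤k s≤k = begin
  prod (weight k s) (suc k)                                           ≡⟨ cong (prod (weight k s)) (cong suc (sym (m+[n∸m]≡n s≤k))) ⟩
  prod (weight k s) (suc s + (k ∸ s))                                 ≡⟨ prod-split (weight k s) (suc s) (k ∸ s) ⟩
  prod (weight k s) (suc s) * prod (λ i → weight k s (suc s + i)) (k ∸ s)
                                                                      ≤⟨ *-mono-≤ (prod-≤-pow k (suc s) small) (≤-reflexive large) ⟩
  k ^ suc s * 1                                                       ≡⟨ *-identityʳ _ ⟩
  k ^ suc s                                                           ∎
  where
  open ≤-Reasoning
  small : ∀ i → i < suc s → weight k s i ≤ k
  small i (s≤s i≤s) with i ≤ᵇ s in eq
  ... | true  = ≤-refl
  ... | false = ⊥-elim (subst T eq (≤⇒≤ᵇ i≤s))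
  large : prod (λ i → weight k s (suc s + i)) (k ∸ s) ≡ 1
  large = prod-ones _ (k ∸ s) (λ i _ → beyond i)
    where
    beyond : ∀ i → weight k s (suc s + i) ≡ 1
    beyond i with suc s + i ≤ᵇ s in eq
    ... | true  = ⊥-elim (<-irrefl refl (≤-trans (s≤s (m≤m+n s i)) (≤ᵇ⇒≤ (suc s + i) s (subst T (sym eq) tt))))
    ... | false = refl

-- p^⌊log_p k⌋ ≤ p · weight(p): always p^L ≤ k, and L ≤ 1 when p > s since then k < p².
pow-lg-≤ : ∀ {p} k s → Prime p → 1 ≤ k → k < suc s * suc s → p ^ lg p k ≤ p * weight k s p
pow-lg-≤ {p} k s pp 1≤k k<[s+1]² with p ≤ᵇ s in eq
... | true  = ≤-trans (proj₂ (lg-spec k (prime≥2 pp)) 1≤k) (m≤n*m k p {{prime⇒nonZero pp}})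
... | false = ^-monoʳ-≤ p {{prime⇒nonZero pp}} L≤1
  where
  p≰s : ¬ p ≤ s
  p≰s p≤s = subst T eq (≤⇒≤ᵇ p≤s)
  L≤1 : lg p k ≤ 1
  L≤1 with lg p k ≤? 1
  ... | yes L≤1 = L≤1
  ... | no  L≰1 = ⊥-elim (<-irrefl refl (<-≤-trans k<[s+1]² (begin
    suc s * suc s     ≤⟨ *-mono-≤ (≰⇒> p≰s) (≰⇒> p≰s) ⟩
    p * p             ≡⟨ cong (p *_) (sym (*-identityʳ p)) ⟩
    p ^ 2             ≤⟨ ^-monoʳ-≤ p {{prime⇒nonZero pp}} (≰⇒> L≰1) ⟩
    p ^ lg p k        ≤⟨ proj₂ (lg-spec k (prime≥2 pp)) 1≤k ⟩
    k                 ∎)))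
    where open ≤-Reasoning

Λ : ℕ → ℕ
Λ k = primeProd (λ p → p ^ lg p k) k

pow-distrib-* : ∀ a b k → (a * b) ^ k ≡ a ^ k * b ^ k
pow-distrib-* a b zero    = refl
pow-distrib-* a b (suc k) = trans (cong (a * b *_) (pow-distrib-* a b k)) (interchange a b (a ^ k) (b ^ k))
  where
  interchange : ∀ a b x y → a * b * (x * y) ≡ a * x * (b * y)
  interchange = solve-∀

Λ-≤ : ∀ k → 1 ≤ k → Λ k ≤ 128 ^ k
Λ-≤ k 1≤k = begin
  Λ k                                     ≤⟨ primeProd-mono k (λ p _ pp → pow-lg-≤ k s pp 1≤k k<[s+1]²) ⟩
  primeProd (λ p → p * weight k s p) k    ≡⟨ primeProd-* (λ p → p) (weight k s) k ⟩
  primorial k * primeProd (weight k s) k  ≤⟨ *-mono-≤ (primorial-≤ k) (prod-mono (suc k) (λ i _ → atPrime-≤ i (weight≥1 i))) ⟩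
  8 ^ k * prod (weight k s) (suc k)       ≤⟨ *-monoʳ-≤ (8 ^ k) (weight-prod-≤ k s 1≤k s≤k) ⟩
  8 ^ k * k ^ suc s                       ≤⟨ *-monoʳ-≤ (8 ^ k) (sqrt-power-≤ k s s²≤k k<[s+1]²) ⟩
  8 ^ k * 16 ^ k                          ≡⟨ sym (pow-distrib-* 8 16 k) ⟩
  128 ^ k                                 ∎
  where
  open ≤-Reasoning
  s = proj₁ (sqrt-floor k)
  s²≤k = proj₁ (proj₂ (sqrt-floor k))
  k<[s+1]² = proj₂ (proj₂ (sqrt-floor k))
  s≤k : s ≤ k
  s≤k = ≤-trans (n≤n*n s) s²≤k
  weight≥1 : ∀ i → 1 ≤ weight k s i
  weight≥1 i with i ≤ᵇ s
  ... | true  = 1≤k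
  ... | false = ≤-refl

-- Stirling-type bounds k! ≤ k^k ≤ 8^k k!.  The second follows from (1 + 1/k)^k ≤ 8, i.e.
-- (k+1)^k ≤ 8 k^k, by induction on k.

!≤pow : ∀ k → k ! ≤ k ^ k
!≤pow zero    = ≤-refl
!≤pow (suc k) = *-monoʳ-≤ (suc k) (≤-trans (!≤pow k) (^-monoˡ-≤ k (n≤1+n k)))

-- (n+1)^j (n-j) ≤ n^(j+1), written with n = j + d.
succ-power-≤ : ∀ j d → suc (j + d) ^ j * d ≤ (j + d) ^ suc j
succ-power-≤ zero    d = ≤-reflexive (trans (*-identityˡ d) (sym (*-identityʳ d)))
succ-power-≤ (suc j) d = begin
  suc n ^ suc j * d          ≡⟨ swap₁ (suc n) (suc n ^ j) d ⟩
  suc n ^ j * (suc n * d)    ≤⟨ *-monoʳ-≤ (suc n ^ j) step ⟩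
  suc n ^ j * (n * suc d)    ≡⟨ swap₂ (suc n ^ j) n (suc d) ⟩
  n * (suc n ^ j * suc d)    ≤⟨ *-monoʳ-≤ n IH ⟩
  n * n ^ suc j              ∎
  where
  open ≤-Reasoning
  n = suc (j + d)
  IH : suc n ^ j * suc d ≤ n ^ suc j
  IH = subst (λ t → suc t ^ j * suc d ≤ t ^ suc j) (+-suc j d) (succ-power-≤ j (suc d))
  step : suc n * d ≤ n * suc d
  step = subst₂ _≤_ (sym (expand₁ n d)) (sym (expand₂ n d)) (+-monoʳ-≤ (n * d) (m≤n⇒m≤1+n (m≤n+m d j)))
    where
    expand₁ : ∀ n d → suc n * d ≡ n * d + d
    expand₁ = solve-∀
    expand₂ : ∀ n d → n * suc d ≡ n * d + n
    expand₂ = solve-∀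
  swap₁ : ∀ a b c → a * b * c ≡ b * (a * c)
  swap₁ = solve-∀
  swap₂ : ∀ a b c → a * (b * c) ≡ b * (a * c)
  swap₂ = solve-∀

-- (k+1)^j ≤ 2 k^j when 2j ≤ k: take n = k, d = k - j ≥ k/2 above.
succ-power-half : ∀ k j → j + j ≤ k → 1 ≤ k → suc k ^ j ≤ 2 * k ^ j
succ-power-half k j 2j≤k 1≤k = *-cancelʳ-≤ (suc k ^ j) (2 * k ^ j) k {{>-nonZero 1≤k}} (begin
  suc k ^ j * k            ≤⟨ *-monoʳ-≤ (suc k ^ j) k≤2d ⟩
  suc k ^ j * (2 * d)      ≡⟨ swap (suc k ^ j) d ⟩
  2 * (suc k ^ j * d)      ≤⟨ *-monoʳ-≤ 2 (subst (λ t → suc t ^ j * d ≤ t ^ suc j) j+d≡k (succ-power-≤ j d)) ⟩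
  2 * (k * k ^ j)          ≡⟨ rotate k (k ^ j) ⟩
  2 * k ^ j * k            ∎)
  where
  open ≤-Reasoning
  d = k ∸ j
  j+d≡k : j + d ≡ k
  j+d≡k = m+[n∸m]≡n (≤-trans (m≤m+n j j) 2j≤k)
  k≤2d : k ≤ 2 * d
  k≤2d = subst₂ _≤_ j+d≡k (sym (2*≡ d)) (+-monoˡ-≤ d (subst (_≤ d) (m+n∸n≡m j j) (∸-monoˡ-≤ j 2j≤k)))
  swap : ∀ a d → a * (2 * d) ≡ 2 * (a * d)
  swap = solve-∀
  rotate : ∀ k x → 2 * (k * x) ≡ 2 * x * k
  rotate = solve-∀

succ-power-≤-8 : ∀ k → 1 ≤ k → suc k ^ k ≤ 8 * k ^ k
succ-power-≤-8 k 1≤k with halving k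
... | even m = begin
  suc k ^ (m + m)                ≡⟨ ^-distribˡ-+-* (suc k) m m ⟩
  suc k ^ m * suc k ^ m          ≤⟨ *-mono-≤ half half ⟩
  2 * k ^ m * (2 * k ^ m)        ≡⟨ regroup (k ^ m) ⟩
  4 * (k ^ m * k ^ m)            ≤⟨ *-monoˡ-≤ (k ^ m * k ^ m) (m≤m+n 4 4) ⟩
  8 * (k ^ m * k ^ m)            ≡⟨ cong (8 *_) (sym (^-distribˡ-+-* k m m)) ⟩
  8 * k ^ (m + m)                ∎
  where
  open ≤-Reasoning
  half = succ-power-half k m ≤-refl 1≤k
  regroup : ∀ x → 2 * x * (2 * x) ≡ 4 * (x * x)
  regroup = solve-∀
... | odd m = begin
  suc k * suc k ^ (m + m)                  ≡⟨ cong (suc k *_) (^-distribˡ-+-* (suc k) m m) ⟩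
  suc k * (suc k ^ m * suc k ^ m)          ≤⟨ *-mono-≤ (subst (_≤ k + k) (+-comm k 1) (+-monoʳ-≤ k 1≤k)) (*-mono-≤ half half) ⟩
  (k + k) * (2 * k ^ m * (2 * k ^ m))      ≡⟨ regroup k (k ^ m) ⟩
  8 * (k * (k ^ m * k ^ m))                ≡⟨ cong (λ t → 8 * (k * t)) (sym (^-distribˡ-+-* k m m)) ⟩
  8 * (k * k ^ (m + m))                    ∎
  where
  open ≤-Reasoning
  half = succ-power-half k m (n≤1+n (m + m)) 1≤k
  regroup : ∀ k x → (k + k) * (2 * x * (2 * x)) ≡ 8 * (k * (x * x))
  regroup = solve-∀

pow≤8^k! : ∀ k → k ^ k ≤ 8 ^ k * k !
pow≤8^k! zero             = ≤-refl
pow≤8^k! (suc zero)       = s≤s z≤n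
pow≤8^k! (suc k@(suc _))  = begin
  suc k * suc k ^ k          ≤⟨ *-monoʳ-≤ (suc k) (succ-power-≤-8 k (s≤s z≤n)) ⟩
  suc k * (8 * k ^ k)        ≤⟨ *-monoʳ-≤ (suc k) (*-monoʳ-≤ 8 (pow≤8^k! k)) ⟩
  suc k * (8 * (8 ^ k * k !)) ≡⟨ regroup (suc k) (8 ^ k) (k !) ⟩
  8 * 8 ^ k * (suc k * k !)  ∎
  where
  open ≤-Reasoning
  regroup : ∀ a b c → a * (8 * (b * c)) ≡ 8 * b * (a * c)
  regroup = solve-∀

a-bounds-at : ∀ a → IsA a → ∀ k p → p ≤ k → Prime p → (a p k ≤ e p k + lg p k) × (e p k ≤ a p k + suc (lg p k))
a-bounds-at a isA k p p≤k pp = a-bounds pp p≤k (proj₁ (isA p k pp) p≤k)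

m′-≤ : ∀ a → IsA a → ∀ k → m′ a k ≤ k ! * Λ k
m′-≤ a isA k = begin
  m′ a k                                      ≡⟨ m′≡primeProd a k ⟩
  primeProd (λ p → p ^ a p k) k               ≤⟨ primeProd-mono k (λ p p≤k pp → ^-monoʳ-≤ p {{prime⇒nonZero pp}}
                                                                       (proj₁ (a-bounds-at a isA k p p≤k pp))) ⟩
  primeProd (λ p → p ^ (e p k + lg p k)) k    ≡⟨ primeProd-cong k (λ p _ _ → ^-distribˡ-+-* p (e p k) (lg p k)) ⟩
  primeProd (λ p → p ^ e p k * p ^ lg p k) k  ≡⟨ primeProd-* (λ p → p ^ e p k) (λ p → p ^ lg p k) k ⟩
  smoothPart k (k !) * Λ k                    ≡⟨ cong (_* Λ k) (smoothPart-! k k ≤-refl) ⟩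
  k ! * Λ k                                   ∎
  where open ≤-Reasoning

!≤m′ : ∀ a → IsA a → ∀ k → k ! ≤ m′ a k * (Λ k * primorial k)
!≤m′ a isA k = begin
  k !                                                     ≡⟨ sym (smoothPart-! k k ≤-refl) ⟩
  primeProd (λ p → p ^ e p k) k                           ≤⟨ primeProd-mono k (λ p p≤k pp → ^-monoʳ-≤ p {{prime⇒nonZero pp}}
                                                                                   (proj₂ (a-bounds-at a isA k p p≤k pp))) ⟩
  primeProd (λ p → p ^ (a p k + suc (lg p k))) k          ≡⟨ primeProd-cong k (λ p _ _ → split p) ⟩
  primeProd (λ p → p ^ a p k * (p ^ lg p k * p)) k        ≡⟨ primeProd-* (λ p → p ^ a p k) _ k ⟩
  primeProd (λ p → p ^ a p k) k * primeProd (λ p → p ^ lg p k * p) k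
                                                          ≡⟨ cong₂ _*_ (sym (m′≡primeProd a k))
                                                                       (primeProd-* (λ p → p ^ lg p k) (λ p → p) k) ⟩
  m′ a k * (Λ k * primorial k)                            ∎
  where
  open ≤-Reasoning
  split : ∀ p → p ^ (a p k + suc (lg p k)) ≡ p ^ a p k * (p ^ lg p k * p)
  split p = trans (^-distribˡ-+-* p (a p k) (suc (lg p k))) (cong (p ^ a p k *_) (*-comm p (p ^ lg p k)))

corollary2 : (a : ℕ → ℕ → ℕ) → IsA a →
    ∃[ C ] ∃[ K ] (∀ k → K ≤ k → (m′ a k ≤ C ^ k * k ^ k) × (k ^ k ≤ C ^ k * m′ a k))
corollary2 a isA = 8192 , 1 , λ k 1≤k → upper k 1≤k , lower k 1≤k
  where
  open ≤-Reasoning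
  upper : ∀ k → 1 ≤ k → m′ a k ≤ 8192 ^ k * k ^ k
  upper k 1≤k = begin
    m′ a k              ≤⟨ m′-≤ a isA k ⟩
    k ! * Λ k           ≤⟨ *-mono-≤ (!≤pow k) (≤-trans (Λ-≤ k 1≤k) (^-monoˡ-≤ k (m≤m+n 128 8064))) ⟩
    k ^ k * 8192 ^ k    ≡⟨ *-comm (k ^ k) (8192 ^ k) ⟩
    8192 ^ k * k ^ k    ∎
  lower : ∀ k → 1 ≤ k → k ^ k ≤ 8192 ^ k * m′ a k
  lower k 1≤k = begin
    k ^ k                                   ≤⟨ pow≤8^k! k ⟩
    8 ^ k * k !                             ≤⟨ *-monoʳ-≤ (8 ^ k) (!≤m′ a isA k) ⟩
    8 ^ k * (m′ a k * (Λ k * primorial k))  ≤⟨ *-monoʳ-≤ (8 ^ k) (*-monoʳ-≤ (m′ a k)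
                                                   (*-mono-≤ (Λ-≤ k 1≤k) (primorial-≤ k))) ⟩
    8 ^ k * (m′ a k * (128 ^ k * 8 ^ k))    ≡⟨ regroup (8 ^ k) (m′ a k) (128 ^ k) ⟩
    8 ^ k * 128 ^ k * 8 ^ k * m′ a k        ≡⟨ cong (_* m′ a k) (sym (trans (pow-distrib-* (8 * 128) 8 k)
                                                                      (cong (_* 8 ^ k) (pow-distrib-* 8 128 k)))) ⟩
    8192 ^ k * m′ a k                       ∎
    where
    regroup : ∀ x m y → x * (m * (y * x)) ≡ x * y * x * m
    regroup = solve-∀
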